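{- Let $m,n\in\mathbb{Z}$ with $m+n$ odd. Then the matrix $$\begin{pmatrix}0&1&n+1\\1&0&m\\0&2&2n+1\end{pmatrix}$$ is $\varsigma$-reduced.
   Context: A matrix $M=(a_{ij})\in SL(3,\mathbb{Z})$ with $a_{31}=0$ is an (upper) Hessenberg matrix; it is perfect if $0\le a_{11}<a_{21}$, $0\le a_{12}<a_{32}$, $0\le a_{22}<a_{32}$. Its Hessenberg complexity is $\varsigma(M)=a_{21}^2a_{32}$. Matrices $M_1,M_2$ are integer conjugate if $M_2=XM_1X^{ -1}$ for some $X\in GL(3,\mathbb{Z})$. A perfect Hessenberg matrix $M$ is $\varsigma$-reduced if its Hessenberg complexity is the least among all perfect Hessenberg matrices integer conjugate to $M$. -}

module Defs where

open import Data.Nat using (ℕ)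
open import Data.Fin using (Fin; zero; suc)
open import Data.Integer using (ℤ; +_; _+_; _-_; _*_; _≤_; _<_)
open import Data.Product using (_×_; Σ; ∃)
open import Relation.Binary.PropositionalEquality using (_≡_)

-- 3×3 integer matrices, indexed from 0: M i j = a_{(i+1)(j+1)}
Mat3 : Set
Mat3 = Fin 3 → Fin 3 → ℤ

𝟘 𝟙 𝟚 : Fin 3
𝟘 = zero
𝟙 = suc zero
𝟚 = suc (suc zero)

_≈_ : Mat3 → Mat3 → Set
A ≈ B = ∀ i j → A i j ≡ B i j

_⊗_ : Mat3 → Mat3 → Mat3
(A ⊗ B) i j = A i 𝟘 * B 𝟘 j + A i 𝟙 * B 𝟙 j + A i 𝟚 * B 𝟚 j

I₃ : Mat3
I₃ zero zero = + 1
I₃ (suc zero) (suc zero) = + 1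
I₃ (suc (suc zero)) (suc (suc zero)) = + 1
I₃ _ _ = + 0

det : Mat3 → ℤ
det A = A 𝟘 𝟘 * (A 𝟙 𝟙 * A 𝟚 𝟚 - A 𝟙 𝟚 * A 𝟚 𝟙)
      - A 𝟘 𝟙 * (A 𝟙 𝟘 * A 𝟚 𝟚 - A 𝟙 𝟚 * A 𝟚 𝟘)
      + A 𝟘 𝟚 * (A 𝟙 𝟘 * A 𝟚 𝟙 - A 𝟙 𝟙 * A 𝟚 𝟘)

InSL : Mat3 → Set
InSL A = det A ≡ + 1

InGL : Mat3 → Set
InGL X = Σ Mat3 λ Y → (X ⊗ Y) ≈ I₃ × (Y ⊗ X) ≈ I₃

IntegerConjugate : Mat3 → Mat3 → Set
IntegerConjugate M₁ M₂ =
  Σ Mat3 λ X → Σ Mat3 λ Y →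
    (X ⊗ Y) ≈ I₃ × (Y ⊗ X) ≈ I₃ × M₂ ≈ ((X ⊗ M₁) ⊗ Y)

IsHessenberg : Mat3 → Set
IsHessenberg M = InSL M × M 𝟚 𝟘 ≡ + 0

IsPerfect : Mat3 → Set
IsPerfect M = IsHessenberg M
  × (+ 0 ≤ M 𝟘 𝟘 × M 𝟘 𝟘 < M 𝟙 𝟘)
  × (+ 0 ≤ M 𝟘 𝟙 × M 𝟘 𝟙 < M 𝟚 𝟙)
  × (+ 0 ≤ M 𝟙 𝟙 × M 𝟙 𝟙 < M 𝟚 𝟙)

ς : Mat3 → ℤ
ς M = M 𝟙 𝟘 * M 𝟙 𝟘 * M 𝟚 𝟙

IsςReduced : Mat3 → Set
IsςReduced M = IsPerfect M ×
  (∀ N → IsPerfect N → IntegerConjugate M N → ς M ≤ ς N)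

Mmn : ℤ → ℤ → Mat3
Mmn m n zero zero = + 0
Mmn m n zero (suc zero) = + 1
Mmn m n zero (suc (suc zero)) = n + + 1
Mmn m n (suc zero) zero = + 1
Mmn m n (suc zero) (suc zero) = + 0
Mmn m n (suc zero) (suc (suc zero)) = m
Mmn m n (suc (suc zero)) zero = + 0
Mmn m n (suc (suc zero)) (suc zero) = + 2
Mmn m n (suc (suc zero)) (suc (suc zero)) = + 2 * n + + 1

{-# OPTIONS --safe #-}
-- ς (Mmn m n) = 2, while a perfect N has a₂₁, a₃₂ ≥ 1, so ς N < 2 forces a₂₁ = a₃₂ = 1.
-- Such an N cannot be integer conjugate to Mmn m n: evenness of all entries of (M − I)² is a
-- conjugacy invariant, as (X M X⁻¹ − I)² = X (M − I)² X⁻¹. For m + n odd every entry of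
-- (Mmn m n − I)² is even, whereas for a Hessenberg N the (3,1) entry of (N − I)² is a₃₂ a₂₁ = 1.
module Submission where

open import Defs
open import Data.Integer using (ℤ; _+_; +_)
open import Data.Integer.Divisibility using (_∣_)
open import Relation.Nullary using (¬_)

open import Data.Empty using (⊥-elim)
open import Data.Fin using (zero; suc)
open import Data.Integer using (_*_; _-_; -_; _≤_; _<_; +≤+; +<+; _/_; _%_)
open import Data.Integer.DivMod using (a≡a%n+[a/n]*n; n%d<d)
open import Data.Integer.Divisibility.Signed as Signed
  using (divides; ∣⇒∣ᵤ; ∣m∣n⇒∣m+n; ∣n⇒∣m*n; ∣m⇒∣m*n)
open import Data.Integer.Properties using (+-identityˡ)
open import Data.Integer.Tactic.RingSolver using (solve-∀)
import Data.Nat as ℕ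
import Data.Nat.Divisibility as ℕ
import Data.Nat.Properties as ℕ
open import Data.Product using (∃-syntax; _×_; _,_)
open import Data.Sum using (_⊎_; inj₁; inj₂)
open import Level using (0ℓ)
open import Relation.Binary.Bundles using (Setoid)
open import Relation.Binary.PropositionalEquality
  using (_≡_; refl; sym; trans; cong; subst)

infixl 6 _⊖_

_⊖_ : Mat3 → Mat3 → Mat3
(A ⊖ B) i j = A i j - B i j

⊖-cong : ∀ {A A′ B B′} → A ≈ A′ → B ≈ B′ → (A ⊖ B) ≈ (A′ ⊖ B′)
⊖-cong p q i j rewrite p i j | q i j = refl

≈-setoid : Setoid 0ℓ 0ℓ
≈-setoid = record
  { Carrier       = Mat3
  ; _≈_           = _≈_
  ; isEquivalence = record
    { refl  = λ i j → refl
    ; sym   = λ p i j → sym (p i j)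
    ; trans = λ p q i j → trans (p i j) (q i j)
    }
  }

module ≈ = Setoid ≈-setoid
open import Relation.Binary.Reasoning.Setoid ≈-setoid

⊗-cong : ∀ {A A′ B B′} → A ≈ A′ → B ≈ B′ → (A ⊗ B) ≈ (A′ ⊗ B′)
⊗-cong p q i j rewrite p i 𝟘 | p i 𝟙 | p i 𝟚 | q 𝟘 j | q 𝟙 j | q 𝟚 j = refl

⊗-congˡ : ∀ A {B B′} → B ≈ B′ → (A ⊗ B) ≈ (A ⊗ B′)
⊗-congˡ A = ⊗-cong (≈.refl {A})

⊗-congʳ : ∀ {A A′} B → A ≈ A′ → (A ⊗ B) ≈ (A′ ⊗ B)
⊗-congʳ B p = ⊗-cong p (≈.refl {B})

⊗-assoc : ∀ A B C → ((A ⊗ B) ⊗ C) ≈ (A ⊗ (B ⊗ C))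
⊗-assoc A B C i j =
  assoc (A i 𝟘) (A i 𝟙) (A i 𝟚)
        (B 𝟘 𝟘) (B 𝟘 𝟙) (B 𝟘 𝟚) (B 𝟙 𝟘) (B 𝟙 𝟙) (B 𝟙 𝟚) (B 𝟚 𝟘) (B 𝟚 𝟙) (B 𝟚 𝟚)
        (C 𝟘 j) (C 𝟙 j) (C 𝟚 j)
  where
  assoc : ∀ a₀ a₁ a₂ b₀₀ b₀₁ b₀₂ b₁₀ b₁₁ b₁₂ b₂₀ b₂₁ b₂₂ c₀ c₁ c₂ →
    (a₀ * b₀₀ + a₁ * b₁₀ + a₂ * b₂₀) * c₀ + (a₀ * b₀₁ + a₁ * b₁₁ + a₂ * b₂₁) * c₁
      + (a₀ * b₀₂ + a₁ * b₁₂ + a₂ * b₂₂) * c₂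
    ≡ a₀ * (b₀₀ * c₀ + b₀₁ * c₁ + b₀₂ * c₂) + a₁ * (b₁₀ * c₀ + b₁₁ * c₁ + b₁₂ * c₂)
      + a₂ * (b₂₀ * c₀ + b₂₁ * c₁ + b₂₂ * c₂)
  assoc = solve-∀

⊗-identityˡ : ∀ A → (I₃ ⊗ A) ≈ A
⊗-identityˡ A zero             j = row₀ (A 𝟘 j) (A 𝟙 j) (A 𝟚 j)
  where
  row₀ : ∀ a b c → + 1 * a + + 0 * b + + 0 * c ≡ a
  row₀ = solve-∀
⊗-identityˡ A (suc zero)       j = row₁ (A 𝟘 j) (A 𝟙 j) (A 𝟚 j)
  where
  row₁ : ∀ a b c → + 0 * a + + 1 * b + + 0 * c ≡ b
  row₁ = solve-∀
⊗-identityˡ A (suc (suc zero)) j = row₂ (A 𝟘 j) (A 𝟙 j) (A 𝟚 j)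
  where
  row₂ : ∀ a b c → + 0 * a + + 0 * b + + 1 * c ≡ c
  row₂ = solve-∀

⊗-identityʳ : ∀ A → (A ⊗ I₃) ≈ A
⊗-identityʳ A i zero             = col₀ (A i 𝟘) (A i 𝟙) (A i 𝟚)
  where
  col₀ : ∀ a b c → a * + 1 + b * + 0 + c * + 0 ≡ a
  col₀ = solve-∀
⊗-identityʳ A i (suc zero)       = col₁ (A i 𝟘) (A i 𝟙) (A i 𝟚)
  where
  col₁ : ∀ a b c → a * + 0 + b * + 1 + c * + 0 ≡ b
  col₁ = solve-∀
⊗-identityʳ A i (suc (suc zero)) = col₂ (A i 𝟘) (A i 𝟙) (A i 𝟚)
  where
  col₂ : ∀ a b c → a * + 0 + b * + 0 + c * + 1 ≡ c
  col₂ = solve-∀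

⊗-distribˡ-⊖ : ∀ A B C → (A ⊗ (B ⊖ C)) ≈ (A ⊗ B ⊖ A ⊗ C)
⊗-distribˡ-⊖ A B C i j =
  distrib (A i 𝟘) (A i 𝟙) (A i 𝟚) (B 𝟘 j) (B 𝟙 j) (B 𝟚 j) (C 𝟘 j) (C 𝟙 j) (C 𝟚 j)
  where
  distrib : ∀ a₀ a₁ a₂ b₀ b₁ b₂ c₀ c₁ c₂ →
    a₀ * (b₀ - c₀) + a₁ * (b₁ - c₁) + a₂ * (b₂ - c₂)
    ≡ (a₀ * b₀ + a₁ * b₁ + a₂ * b₂) - (a₀ * c₀ + a₁ * c₁ + a₂ * c₂)
  distrib = solve-∀

⊗-distribʳ-⊖ : ∀ A B C → ((A ⊖ B) ⊗ C) ≈ (A ⊗ C ⊖ B ⊗ C)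
⊗-distribʳ-⊖ A B C i j =
  distrib (A i 𝟘) (A i 𝟙) (A i 𝟚) (B i 𝟘) (B i 𝟙) (B i 𝟚) (C 𝟘 j) (C 𝟙 j) (C 𝟚 j)
  where
  distrib : ∀ a₀ a₁ a₂ b₀ b₁ b₂ c₀ c₁ c₂ →
    (a₀ - b₀) * c₀ + (a₁ - b₁) * c₁ + (a₂ - b₂) * c₂
    ≡ (a₀ * c₀ + a₁ * c₁ + a₂ * c₂) - (b₀ * c₀ + b₁ * c₁ + b₂ * c₂)
  distrib = solve-∀

conjugate-⊖-I₃ : ∀ {M N X Y} → (X ⊗ Y) ≈ I₃ → N ≈ ((X ⊗ M) ⊗ Y) →
  (N ⊖ I₃) ≈ ((X ⊗ (M ⊖ I₃)) ⊗ Y)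
conjugate-⊖-I₃ {M} {N} {X} {Y} XY≈I N≈XMY = begin
  N ⊖ I₃                          ≈⟨ ⊖-cong N≈XMY (≈.sym XY≈I) ⟩
  (X ⊗ M) ⊗ Y ⊖ X ⊗ Y             ≈⟨ ⊖-cong (≈.refl {(X ⊗ M) ⊗ Y}) (⊗-congʳ Y (⊗-identityʳ X)) ⟨
  (X ⊗ M) ⊗ Y ⊖ (X ⊗ I₃) ⊗ Y      ≈⟨ ⊗-distribʳ-⊖ (X ⊗ M) (X ⊗ I₃) Y ⟨
  (X ⊗ M ⊖ X ⊗ I₃) ⊗ Y            ≈⟨ ⊗-congʳ Y (⊗-distribˡ-⊖ X M I₃) ⟨
  (X ⊗ (M ⊖ I₃)) ⊗ Y              ∎

conjugate-square : ∀ X Y A → (Y ⊗ X) ≈ I₃ →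
  (((X ⊗ A) ⊗ Y) ⊗ ((X ⊗ A) ⊗ Y)) ≈ ((X ⊗ (A ⊗ A)) ⊗ Y)
conjugate-square X Y A YX≈I = begin
  ((X ⊗ A) ⊗ Y) ⊗ ((X ⊗ A) ⊗ Y)   ≈⟨ ⊗-assoc (X ⊗ A) Y ((X ⊗ A) ⊗ Y) ⟩
  (X ⊗ A) ⊗ (Y ⊗ ((X ⊗ A) ⊗ Y))   ≈⟨ ⊗-congˡ (X ⊗ A) (⊗-assoc Y (X ⊗ A) Y) ⟨
  (X ⊗ A) ⊗ ((Y ⊗ (X ⊗ A)) ⊗ Y)   ≈⟨ ⊗-congˡ (X ⊗ A) (⊗-congʳ Y (⊗-assoc Y X A)) ⟨
  (X ⊗ A) ⊗ (((Y ⊗ X) ⊗ A) ⊗ Y)   ≈⟨ ⊗-congˡ (X ⊗ A) (⊗-congʳ Y (⊗-congʳ A YX≈I)) ⟩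
  (X ⊗ A) ⊗ ((I₃ ⊗ A) ⊗ Y)        ≈⟨ ⊗-congˡ (X ⊗ A) (⊗-congʳ Y (⊗-identityˡ A)) ⟩
  (X ⊗ A) ⊗ (A ⊗ Y)               ≈⟨ ⊗-assoc (X ⊗ A) A Y ⟨
  ((X ⊗ A) ⊗ A) ⊗ Y               ≈⟨ ⊗-congʳ Y (⊗-assoc X A A) ⟩
  (X ⊗ (A ⊗ A)) ⊗ Y               ∎

infix 4 _∣ₘ_

_∣ₘ_ : ℤ → Mat3 → Set
k ∣ₘ A = ∀ i j → k Signed.∣ A i j

∣ₘ-respʳ-≈ : ∀ {k A B} → A ≈ B → k ∣ₘ A → k ∣ₘ B
∣ₘ-respʳ-≈ {k} A≈B k∣A i j = subst (k Signed.∣_) (A≈B i j) (k∣A i j)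

∣ₘB⇒∣ₘA⊗B : ∀ {k} A {B} → k ∣ₘ B → k ∣ₘ A ⊗ B
∣ₘB⇒∣ₘA⊗B A k∣B i j =
  ∣m∣n⇒∣m+n (∣m∣n⇒∣m+n (∣n⇒∣m*n (A i 𝟘) (k∣B 𝟘 j)) (∣n⇒∣m*n (A i 𝟙) (k∣B 𝟙 j)))
            (∣n⇒∣m*n (A i 𝟚) (k∣B 𝟚 j))

∣ₘA⇒∣ₘA⊗B : ∀ {k A} B → k ∣ₘ A → k ∣ₘ A ⊗ B
∣ₘA⇒∣ₘA⊗B B k∣A i j =
  ∣m∣n⇒∣m+n (∣m∣n⇒∣m+n (∣m⇒∣m*n (B 𝟘 j) (k∣A i 𝟘)) (∣m⇒∣m*n (B 𝟙 j) (k∣A i 𝟙)))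
            (∣m⇒∣m*n (B 𝟚 j) (k∣A i 𝟚))

conjugate-∣ₘ-[⊖I₃]² : ∀ {k M N} → IntegerConjugate M N →
  k ∣ₘ (M ⊖ I₃) ⊗ (M ⊖ I₃) → k ∣ₘ (N ⊖ I₃) ⊗ (N ⊖ I₃)
conjugate-∣ₘ-[⊖I₃]² {M = M} {N} (X , Y , XY≈I , YX≈I , N≈XMY) k∣D² =
  ∣ₘ-respʳ-≈ (≈.sym [N⊖I₃]²≈XD²Y) (∣ₘA⇒∣ₘA⊗B Y (∣ₘB⇒∣ₘA⊗B X k∣D²))
  where
  N⊖I₃≈XDY : (N ⊖ I₃) ≈ ((X ⊗ (M ⊖ I₃)) ⊗ Y)
  N⊖I₃≈XDY = conjugate-⊖-I₃ {M} {N} {X} {Y} XY≈I N≈XMY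

  [N⊖I₃]²≈XD²Y : ((N ⊖ I₃) ⊗ (N ⊖ I₃)) ≈ ((X ⊗ ((M ⊖ I₃) ⊗ (M ⊖ I₃))) ⊗ Y)
  [N⊖I₃]²≈XD²Y =
    ≈.trans (⊗-cong N⊖I₃≈XDY N⊖I₃≈XDY) (conjugate-square X Y (M ⊖ I₃) YX≈I)

odd⇒≡2t+1 : ∀ x → ¬ (+ 2 ∣ x) → ∃[ t ] x ≡ + 2 * t + + 1
odd⇒≡2t+1 x 2∤x with x % + 2 | n%d<d x (+ 2) | a≡a%n+[a/n]*n x (+ 2)
... | 0 | _ | x≡0+[x/2]*2 =
  ⊥-elim (2∤x (∣⇒∣ᵤ (divides (x / + 2) (trans x≡0+[x/2]*2 (+-identityˡ _)))))
... | 1 | _ | x≡1+[x/2]*2 = x / + 2 , trans x≡1+[x/2]*2 (1+q*2≡2q+1 (x / + 2))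
  where
  1+q*2≡2q+1 : ∀ q → + 1 + q * + 2 ≡ + 2 * q + + 1
  1+q*2≡2q+1 = solve-∀
... | ℕ.suc (ℕ.suc _) | ℕ.s≤s (ℕ.s≤s ()) | _

2∤1 : ¬ (+ 2 Signed.∣ + 1)
2∤1 2∣1 with ℕ.∣1⇒≡1 (∣⇒∣ᵤ 2∣1)
... | ()

-- Eliminating m = 2t + 1 - n turns each entry into a polynomial identity in n and t; the
-- left-hand sides below are the entries of D ⊗ D as they unfold, hence the "- + 0" terms.
Mmn-2t+1-n-[⊖I₃]²-even : ∀ n t → let D = Mmn (+ 2 * t + + 1 - n) n ⊖ I₃ in + 2 ∣ₘ D ⊗ D
Mmn-2t+1-n-[⊖I₃]²-even n t zero             zero             = divides (+ 1) (e₀₀ n t)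
  where
  e₀₀ : ∀ (n t : ℤ) → - + 1 * - + 1 + + 1 * + 1 + ((n + + 1) - + 0) * + 0 ≡ + 1 * + 2
  e₀₀ = solve-∀
Mmn-2t+1-n-[⊖I₃]²-even n t zero             (suc zero)       = divides n (e₀₁ n t)
  where
  e₀₁ : ∀ (n t : ℤ) → - + 1 * + 1 + + 1 * - + 1 + ((n + + 1) - + 0) * + 2 ≡ n * + 2
  e₀₁ = solve-∀
Mmn-2t+1-n-[⊖I₃]²-even n t zero             (suc (suc zero)) = divides (t + n * n) (e₀₂ n t)
  where
  e₀₂ : ∀ (n t : ℤ) → - + 1 * ((n + + 1) - + 0) + + 1 * ((+ 2 * t + + 1 - n) - + 0)
        + ((n + + 1) - + 0) * ((+ 2 * n + + 1) - + 1)
      ≡ (t + n * n) * + 2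
  e₀₂ = solve-∀
Mmn-2t+1-n-[⊖I₃]²-even n t (suc zero)       zero             = divides (- + 1) (e₁₀ n t)
  where
  e₁₀ : ∀ (n t : ℤ) → + 1 * - + 1 + - + 1 * + 1 + ((+ 2 * t + + 1 - n) - + 0) * + 0 ≡ - + 1 * + 2
  e₁₀ = solve-∀
Mmn-2t+1-n-[⊖I₃]²-even n t (suc zero)       (suc zero)       = divides (+ 1 + m) (e₁₁ n t)
  where
  m = + 2 * t + + 1 - n
  e₁₁ : ∀ (n t : ℤ) → + 1 * + 1 + - + 1 * - + 1 + ((+ 2 * t + + 1 - n) - + 0) * + 2
      ≡ (+ 1 + (+ 2 * t + + 1 - n)) * + 2
  e₁₁ = solve-∀
Mmn-2t+1-n-[⊖I₃]²-even n t (suc zero)       (suc (suc zero)) = divides (n - t + m * n) (e₁₂ n t)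
  where
  m = + 2 * t + + 1 - n
  e₁₂ : ∀ (n t : ℤ) → + 1 * ((n + + 1) - + 0) + - + 1 * ((+ 2 * t + + 1 - n) - + 0)
        + ((+ 2 * t + + 1 - n) - + 0) * ((+ 2 * n + + 1) - + 1)
      ≡ (n - t + (+ 2 * t + + 1 - n) * n) * + 2
  e₁₂ = solve-∀
Mmn-2t+1-n-[⊖I₃]²-even n t (suc (suc zero)) zero             = divides (+ 1) (e₂₀ n t)
  where
  e₂₀ : ∀ (n t : ℤ) → + 0 * - + 1 + + 2 * + 1 + ((+ 2 * n + + 1) - + 1) * + 0 ≡ + 1 * + 2
  e₂₀ = solve-∀
Mmn-2t+1-n-[⊖I₃]²-even n t (suc (suc zero)) (suc zero)       = divides (+ 2 * n - + 1) (e₂₁ n t)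
  where
  e₂₁ : ∀ (n t : ℤ) → + 0 * + 1 + + 2 * - + 1 + ((+ 2 * n + + 1) - + 1) * + 2
      ≡ (+ 2 * n - + 1) * + 2
  e₂₁ = solve-∀
Mmn-2t+1-n-[⊖I₃]²-even n t (suc (suc zero)) (suc (suc zero)) = divides (m + + 2 * (n * n)) (e₂₂ n t)
  where
  m = + 2 * t + + 1 - n
  e₂₂ : ∀ (n t : ℤ) → + 0 * ((n + + 1) - + 0) + + 2 * ((+ 2 * t + + 1 - n) - + 0)
        + ((+ 2 * n + + 1) - + 1) * ((+ 2 * n + + 1) - + 1)
      ≡ ((+ 2 * t + + 1 - n) + + 2 * (n * n)) * + 2
  e₂₂ = solve-∀

Mmn-[⊖I₃]²-even : ∀ m n → ¬ (+ 2 ∣ m + n) → + 2 ∣ₘ (Mmn m n ⊖ I₃) ⊗ (Mmn m n ⊖ I₃)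
Mmn-[⊖I₃]²-even m n m+n-odd with odd⇒≡2t+1 (m + n) m+n-odd
... | t , m+n≡2t+1 =
  subst (λ m → + 2 ∣ₘ (Mmn m n ⊖ I₃) ⊗ (Mmn m n ⊖ I₃)) (sym m≡2t+1-n) (Mmn-2t+1-n-[⊖I₃]²-even n t)
  where
  m≡[m+n]-n : ∀ m n → m ≡ (m + n) - n
  m≡[m+n]-n = solve-∀
  m≡2t+1-n : m ≡ + 2 * t + + 1 - n
  m≡2t+1-n = trans (m≡[m+n]-n m n) (cong (_- n) m+n≡2t+1)

Mmn-perfect : ∀ m n → IsPerfect (Mmn m n)
Mmn-perfect m n =
  (det≡1 m n , refl)
  , (+≤+ ℕ.z≤n , +<+ (ℕ.s≤s ℕ.z≤n))
  , (+≤+ ℕ.z≤n , +<+ (ℕ.s≤s (ℕ.s≤s ℕ.z≤n)))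
  , (+≤+ ℕ.z≤n , +<+ (ℕ.s≤s ℕ.z≤n))
  where
  det≡1 : ∀ m n → + 0 * (+ 0 * (+ 2 * n + + 1) - m * + 2) - + 1 * (+ 1 * (+ 2 * n + + 1) - m * + 0)
                  + (n + + 1) * (+ 1 * + 2 - + 0 * + 0) ≡ + 1
  det≡1 = solve-∀

Hessenberg-[⊖I₃]²₃₁ : ∀ N → N 𝟚 𝟘 ≡ + 0 → ((N ⊖ I₃) ⊗ (N ⊖ I₃)) 𝟚 𝟘 ≡ N 𝟚 𝟙 * N 𝟙 𝟘
Hessenberg-[⊖I₃]²₃₁ N a₃₁≡0 rewrite a₃₁≡0 = entry (N 𝟘 𝟘) (N 𝟚 𝟙) (N 𝟙 𝟘) (N 𝟚 𝟚)
  where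
  entry : ∀ a₁₁ a₃₂ a₂₁ a₃₃ →
    + 0 * (a₁₁ - + 1) + (a₃₂ - + 0) * (a₂₁ - + 0) + (a₃₃ - + 1) * + 0 ≡ a₃₂ * a₂₁
  entry = solve-∀

Hessenberg-unit⇒[⊖I₃]²-not-even : ∀ {N} → IsHessenberg N → N 𝟙 𝟘 ≡ + 1 → N 𝟚 𝟙 ≡ + 1 →
  ¬ (+ 2 ∣ₘ (N ⊖ I₃) ⊗ (N ⊖ I₃))
Hessenberg-unit⇒[⊖I₃]²-not-even {N} (_ , a₃₁≡0) a₂₁≡1 a₃₂≡1 2∣D² =
  2∤1 (subst (+ 2 Signed.∣_) D²₃₁≡1 (2∣D² 𝟚 𝟘))
  where
  D²₃₁≡1 : ((N ⊖ I₃) ⊗ (N ⊖ I₃)) 𝟚 𝟘 ≡ + 1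
  D²₃₁≡1 rewrite Hessenberg-[⊖I₃]²₃₁ N a₃₁≡0 | a₂₁≡1 | a₃₂≡1 = refl

0≤i<j⇒j≡1+n : ∀ {i j} → + 0 ≤ i → i < j → ∃[ n ] j ≡ + ℕ.suc n
0≤i<j⇒j≡1+n (+≤+ _) (+<+ {n = ℕ.suc n} _) = n , refl
0≤i<j⇒j≡1+n (+≤+ _) (+<+ {n = ℕ.zero} ())

perfect⇒unit⊎2≤ς : ∀ {N} → IsPerfect N → (N 𝟙 𝟘 ≡ + 1 × N 𝟚 𝟙 ≡ + 1) ⊎ + 2 ≤ ς N
perfect⇒unit⊎2≤ς {N} (_ , (0≤a₁₁ , a₁₁<a₂₁) , (0≤a₁₂ , a₁₂<a₃₂) , _)
  with 0≤i<j⇒j≡1+n 0≤a₁₁ a₁₁<a₂₁ | 0≤i<j⇒j≡1+n 0≤a₁₂ a₁₂<a₃₂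
... | p , a₂₁≡1+p | q , a₃₂≡1+q rewrite a₂₁≡1+p | a₃₂≡1+q = bound p q
  where
  bound : ∀ p q → (+ ℕ.suc p ≡ + 1 × + ℕ.suc q ≡ + 1) ⊎ + 2 ≤ + ℕ.suc p * + ℕ.suc p * + ℕ.suc q
  bound 0           0           = inj₁ (refl , refl)
  bound 0           (ℕ.suc q)   = inj₂ (+≤+ (ℕ.s≤s (ℕ.s≤s ℕ.z≤n)))
  bound (ℕ.suc p)   q           = inj₂ (+≤+ (ℕ.≤-trans (ℕ.s≤s (ℕ.s≤s ℕ.z≤n))
    (ℕ.≤-trans (ℕ.m≤m*n (2 ℕ.+ p) (2 ℕ.+ p)) (ℕ.m≤m*n _ (ℕ.suc q)))))

mainTheorem13 : (m n : ℤ) → ¬ (+ 2 ∣ m + n) → IsςReduced (Mmn m n)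
mainTheorem13 m n m+n-odd = Mmn-perfect m n , ς-minimal
  where
  ς-minimal : ∀ N → IsPerfect N → IntegerConjugate (Mmn m n) N → ς (Mmn m n) ≤ ς N
  ς-minimal N perfect@(hessenberg , _) conj with perfect⇒unit⊎2≤ς {N} perfect
  ... | inj₂ 2≤ςN = 2≤ςN
  ... | inj₁ (a₂₁≡1 , a₃₂≡1) =
    ⊥-elim (Hessenberg-unit⇒[⊖I₃]²-not-even {N} hessenberg a₂₁≡1 a₃₂≡1
      (conjugate-∣ₘ-[⊖I₃]² {M = Mmn m n} {N} conj (Mmn-[⊖I₃]²-even m n m+n-odd)))
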